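{- There are no games $X,Y$, both of type $\mathcal O$, such that $X+Y$ is of type $\mathcal O$. (That is, if the second player has a winning strategy in each of two three-player games, the second player does not have a winning strategy in their disjunctive sum.)
   Context: A (finite impartial) game is defined recursively as a finite set of games, its options; $0$ is the game with no options. Three players alternate moves cyclically; a move replaces the current game by one of its options, and the player who makes the last move wins. The disjunctive sum $G+H$ is the game whose options are all $G'+H$ ($G'$ an option of $G$) and all $G+H'$ ($H'$ an option of $H$). Types are defined recursively: $G$ is of type $\mathcal N$ iff it has some option of type $\mathcal P$; of type $\mathcal O$ iff it has at least one option and all its options are of type $\mathcal N$; of type $\mathcal P$ iff all its options are of type $\mathcal O$ (so $0$ is of type $\mathcal P$); of type $\mathcal Q$ otherwise. Type $\mathcal O$ means exactly that the second player to move has a strategy winning against all play of the other two. -}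

module Defs where

open import Data.Nat using (ℕ; _+_; _>_)
open import Data.Fin using (Fin; splitAt)
open import Data.Sum using (_⊎_; [_,_])
open import Data.Product using (Σ; _×_)

-- A finite impartial game: given by its (finitely many) options,
-- indexed by Fin n. (Repetitions are harmless: all notions below
-- depend only on the set of options.)
data Game : Set where
  mk : (n : ℕ) → (Fin n → Game) → Game

zeroG : Game
zeroG = mk 0 (λ ())

infixl 6 _⊕_
_⊕_ : Game → Game → Game
mk n f ⊕ mk m g =
  mk (n + m) (λ k → [ (λ i → f i ⊕ mk m g) , (λ j → mk n f ⊕ g j) ] (splitAt n k))

-- Three-player outcome types N, O, P (Q = none of these).
isN isO isP : Game → Set
isN (mk n f) = Σ (Fin n) (λ i → isP (f i))
isO (mk n f) = (n > 0) × ((i : Fin n) → isN (f i))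
isP (mk n f) = (i : Fin n) → isO (f i)

-- Let X, Y be of type O with X ⊕ Y of type O. Whatever first move X → X₁ is
-- made, the second player's winning reply in X₁ ⊕ Y stays inside X₁
-- (X₁ → X₂ with X₂ ⊕ Y of type P): a reply Y → Y′ would force X₁ to be of
-- type O, but X₁ is of type N. Symmetrically X ⊕ Y₂ is of type P for some
-- Y₂ two moves below Y. Then X₂ ⊕ Y₂ is of type N, and its winning move,
-- say X₂ → X₃, gives X₃ ⊕ Y₂ of type P. Since X ⊕ Y₂ is of type P as well,
-- X₃ has the type of X, namely O, and X₃ ⊕ Y is of type O as an option of
-- X₂ ⊕ Y. So (X₃, Y) is a strictly smaller counterexample, and infinite
-- descent finishes the proof.
{-# OPTIONS --safe #-}
module Submission where

open import Defs
open import Data.Nat using (suc; s≤s; z≤n; >-nonZero⁻¹)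
open import Data.Fin using (Fin; zero; splitAt; _↑ˡ_; _↑ʳ_)
open import Data.Fin.Properties using (splitAt-↑ˡ; splitAt-↑ʳ; nonZeroIndex)
open import Data.Product using (Σ; _×_; _,_; ∃; proj₂)
open import Data.Sum using (_⊎_; inj₁; inj₂; [_,_])
open import Data.Empty using (⊥-elim)
open import Relation.Nullary using (¬_)
open import Relation.Binary.PropositionalEquality using (subst; cong)
open import Relation.Binary.Construct.Closure.Transitive using (TransClosure; [_]; _∷_; wellFounded)
open import Induction.WellFounded using (WellFounded; Acc; acc)

infix 4 _◁_ _◁⁺_

data _◁_ : Game → Game → Set where
  option : ∀ {n} (f : Fin n → Game) (i : Fin n) → f i ◁ mk n f

_◁⁺_ : Game → Game → Set
_◁⁺_ = TransClosure _◁_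

◁-wellFounded : WellFounded _◁_
◁-wellFounded (mk n f) = acc λ { (option _ i) → ◁-wellFounded (f i) }

◁⁺-wellFounded : WellFounded _◁⁺_
◁⁺-wellFounded = wellFounded _◁_ ◁-wellFounded

variable
  G H X Y X′ Y′ : Game

N-intro : H ◁ G → isP H → isN G
N-intro (option f i) pH = i , pH

N-elim : ∀ G → isN G → ∃ λ H → H ◁ G × isP H
N-elim (mk n f) (i , pH) = f i , option f i , pH

O-intro : H ◁ G → (∀ {H} → H ◁ G → isN H) → isO G
O-intro (option {n} f i) nO = >-nonZero⁻¹ n {{nonZeroIndex i}} , λ j → nO (option f j)

O-option : ∀ G → isO G → ∃ λ H → H ◁ G
O-option (mk (suc n) f) _ = f zero , option f zero

O-elim : ∀ G → isO G → H ◁ G → isN H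
O-elim _ (_ , nO) (option f i) = nO i

P-intro : ∀ G → (∀ {H} → H ◁ G → isO H) → isP G
P-intro (mk n f) oO i = oO (option f i)

P-elim : ∀ G → isP G → H ◁ G → isO H
P-elim _ pG (option f i) = pG i

N⇒¬P : ∀ G → isN G → ¬ isP G
O⇒¬P : ∀ G → isO G → ¬ isP G
N⇒¬O : ∀ G → isN G → ¬ isO G
N⇒¬P (mk n f) (i , pH) pG = O⇒¬P (f i) (pG i) pH
O⇒¬P (mk (suc n) f) (_ , nO) pG = N⇒¬O (f zero) (nO zero) (pG zero)
N⇒¬O (mk n f) (i , pH) (_ , nO) = N⇒¬P (f i) (nO i) pH

◁-⊕ˡ : ∀ Y → X′ ◁ X → X′ ⊕ Y ◁ X ⊕ Y
◁-⊕ˡ {X = X} (mk m g) (option {n} f i) =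
  subst (_◁ X ⊕ mk m g) (cong ([_,_] _ _) (splitAt-↑ˡ n i m)) (option _ (i ↑ˡ m))

◁-⊕ʳ : ∀ X → Y′ ◁ Y → X ⊕ Y′ ◁ X ⊕ Y
◁-⊕ʳ {Y = Y} (mk n f) (option {m} g j) =
  subst (_◁ mk n f ⊕ Y) (cong ([_,_] _ _) (splitAt-↑ʳ n m j)) (option _ (n ↑ʳ j))

data SumOption (X Y : Game) : Game → Set where
  left  : X′ ◁ X → SumOption X Y (X′ ⊕ Y)
  right : Y′ ◁ Y → SumOption X Y (X ⊕ Y′)

sum-option : ∀ X Y → H ◁ X ⊕ Y → SumOption X Y H
sum-option (mk n f) (mk m g) (option _ k) with splitAt n k
... | inj₁ i = left (option f i)
... | inj₂ j = right (option g j)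

⊕-comm-option : ∀ X Y → H ◁ X ⊕ Y → ∃ λ H′ → H′ ◁ Y ⊕ X
⊕-comm-option X Y H◁ with sum-option X Y H◁
... | left  X′◁X = _ , ◁-⊕ʳ Y X′◁X
... | right Y′◁Y = _ , ◁-⊕ˡ X Y′◁Y

-- Options are matched as `option f i` wherever a lemma recurses on them:
-- this exposes `f i` as a structural subterm for the termination checker.
⊕-comm-N : ∀ X Y → isN (X ⊕ Y) → isN (Y ⊕ X)
⊕-comm-O : ∀ X Y → isO (X ⊕ Y) → isO (Y ⊕ X)
⊕-comm-P : ∀ X Y → isP (X ⊕ Y) → isP (Y ⊕ X)
⊕-comm-N X Y nXY with N-elim (X ⊕ Y) nXY
... | _ , H◁ , pH with sum-option X Y H◁
... | left  (option f i) = N-intro (◁-⊕ʳ Y (option f i)) (⊕-comm-P (f i) Y pH)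
... | right (option g j) = N-intro (◁-⊕ˡ X (option g j)) (⊕-comm-P X (g j) pH)
⊕-comm-O X Y oXY with O-option (X ⊕ Y) oXY
... | _ , H◁ = O-intro (proj₂ (⊕-comm-option X Y H◁)) (λ H◁′ → swap (sum-option Y X H◁′))
  where
  swap : SumOption Y X H → isN H
  swap (left  (option g j)) = ⊕-comm-N X (g j) (O-elim (X ⊕ Y) oXY (◁-⊕ʳ X (option g j)))
  swap (right (option f i)) = ⊕-comm-N (f i) Y (O-elim (X ⊕ Y) oXY (◁-⊕ˡ Y (option f i)))
⊕-comm-P X Y pXY = P-intro (Y ⊕ X) (λ H◁ → swap (sum-option Y X H◁))
  where
  swap : SumOption Y X H → isO H
  swap (left  (option g j)) = ⊕-comm-O X (g j) (P-elim (X ⊕ Y) pXY (◁-⊕ʳ X (option g j)))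
  swap (right (option f i)) = ⊕-comm-O (f i) Y (P-elim (X ⊕ Y) pXY (◁-⊕ˡ Y (option f i)))

emptyˡ-⊕-N : ∀ f Y → isN (mk 0 f ⊕ Y) → isN Y
emptyˡ-⊕-O : ∀ f Y → isO (mk 0 f ⊕ Y) → isO Y
emptyˡ-⊕-P : ∀ f Y → isP (mk 0 f ⊕ Y) → isP Y
emptyˡ-⊕-N f (mk m g) (j , pH) = j , emptyˡ-⊕-P f (g j) pH
emptyˡ-⊕-O f (mk m g) (m>0 , nO) = m>0 , λ j → emptyˡ-⊕-N f (g j) (nO j)
emptyˡ-⊕-P f (mk m g) oO = λ j → emptyˡ-⊕-O f (g j) (oO j)

-- ⊕T-U⇒V : if Y is of type T and X ⊕ Y of type U, then X is of type V.
⊕P-N⇒N : ∀ X Y → isP Y → isN (X ⊕ Y) → isN X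
⊕P-O⇒O : ∀ X Y → isP Y → isO (X ⊕ Y) → isO X
⊕P-P⇒P : ∀ X Y → isP Y → isP (X ⊕ Y) → isP X
⊕O-P⇒N : ∀ X Y → isO Y → isP (X ⊕ Y) → isN X
⊕N-O⇒N : ∀ X Y → isN Y → isO (X ⊕ Y) → isN X
⊕P-N⇒N X Y pY nXY with N-elim (X ⊕ Y) nXY
... | _ , H◁ , pH with sum-option X Y H◁
... | left  (option f i) = N-intro (option f i) (⊕P-P⇒P (f i) Y pY pH)
... | right (option g j) = ⊕O-P⇒N X (g j) (P-elim Y pY (option g j)) pH
⊕P-O⇒O (mk 0 f) Y pY oXY = ⊥-elim (O⇒¬P Y (emptyˡ-⊕-O f Y oXY) pY)
⊕P-O⇒O X@(mk (suc n) f) Y pY oXY =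
  s≤s z≤n , λ i → ⊕P-N⇒N (f i) Y pY (O-elim (X ⊕ Y) oXY (◁-⊕ˡ Y (option f i)))
⊕P-P⇒P X@(mk n f) Y pY pXY =
  λ i → ⊕P-O⇒O (f i) Y pY (P-elim (X ⊕ Y) pXY (◁-⊕ˡ Y (option f i)))
⊕O-P⇒N X Y oY pXY with O-option Y oY
... | _ , option g j =
  ⊕N-O⇒N X (g j) (O-elim Y oY (option g j)) (P-elim (X ⊕ Y) pXY (◁-⊕ʳ X (option g j)))
⊕N-O⇒N X Y nY oXY with N-elim Y nY
... | _ , option g j , pYⱼ = ⊕P-N⇒N X (g j) pYⱼ (O-elim (X ⊕ Y) oXY (◁-⊕ʳ X (option g j)))

⊕N-P⇒O : ∀ X Y → isN Y → isP (X ⊕ Y) → isO X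
⊕N-P⇒O X Y nY pXY with N-elim Y nY
... | _ , Y′◁Y , pY′ = ⊕P-O⇒O X _ pY′ (P-elim (X ⊕ Y) pXY (◁-⊕ʳ X Y′◁Y))

P-partner-O : ∀ X Z W → isO X → isP (X ⊕ Z) → isP (W ⊕ Z) → isO W
P-partner-O X Z W oX pXZ pWZ = ⊕N-P⇒O W Z (⊕O-P⇒N Z X oX (⊕-comm-P X Z pXZ)) pWZ

Counterexample : Game → Game → Set
Counterexample X Y = isO X × isO Y × isO (X ⊕ Y)

Counterexample-sym : Counterexample X Y → Counterexample Y X
Counterexample-sym {X} {Y} (oX , oY , oXY) = oY , oX , ⊕-comm-O X Y oXY

Counterexample-replyˡ : ∀ {X₁} → Counterexample X Y → X₁ ◁ X →
                        ∃ λ X₂ → X₂ ◁ X₁ × isP (X₂ ⊕ Y)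
Counterexample-replyˡ {X} {Y} {X₁} (oX , oY , oXY) X₁◁X
  with N-elim (X₁ ⊕ Y) (O-elim (X ⊕ Y) oXY (◁-⊕ˡ Y X₁◁X))
... | _ , H◁ , pH with sum-option X₁ Y H◁
... | left  X₂◁X₁ = _ , X₂◁X₁ , pH
... | right Y′◁Y  = ⊥-elim (N⇒¬O X₁ (O-elim X oX X₁◁X) (⊕N-P⇒O X₁ _ (O-elim Y oY Y′◁Y) pH))

Counterexample-replyʳ : ∀ {Y₁} → Counterexample X Y → Y₁ ◁ Y →
                        ∃ λ Y₂ → Y₂ ◁ Y₁ × isP (X ⊕ Y₂)
Counterexample-replyʳ {X} c Y₁◁Y with Counterexample-replyˡ (Counterexample-sym c) Y₁◁Y
... | Y₂ , Y₂◁Y₁ , pY₂X = Y₂ , Y₂◁Y₁ , ⊕-comm-P Y₂ X pY₂X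

smaller-counterexample : Counterexample X Y →
  (∃ λ X′ → X′ ◁⁺ X × Counterexample X′ Y) ⊎ (∃ λ Y′ → Y′ ◁⁺ Y × Counterexample X Y′)
smaller-counterexample {X} {Y} c@(oX , oY , _)
  with O-option X oX | O-option Y oY
... | X₁ , X₁◁X | Y₁ , Y₁◁Y
  with Counterexample-replyˡ c X₁◁X | Counterexample-replyʳ c Y₁◁Y
... | X₂ , X₂◁X₁ , pX₂Y | Y₂ , Y₂◁Y₁ , pXY₂
  with N-elim (X₂ ⊕ Y₂) (O-elim (X₂ ⊕ Y₁) (P-elim (X₂ ⊕ Y) pX₂Y (◁-⊕ʳ X₂ Y₁◁Y)) (◁-⊕ʳ X₂ Y₂◁Y₁))
... | _ , H◁ , pH with sum-option X₂ Y₂ H◁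
... | left X₃◁X₂ =
  inj₁ (_ , X₃◁X₂ ∷ X₂◁X₁ ∷ [ X₁◁X ] ,
        P-partner-O X Y₂ _ oX pXY₂ pH , oY , P-elim (X₂ ⊕ Y) pX₂Y (◁-⊕ˡ Y X₃◁X₂))
... | right Y₃◁Y₂ =
  inj₂ (_ , Y₃◁Y₂ ∷ Y₂◁Y₁ ∷ [ Y₁◁Y ] ,
        oX , P-partner-O Y X₂ _ oY (⊕-comm-P X₂ Y pX₂Y) (⊕-comm-P X₂ _ pH) ,
        P-elim (X ⊕ Y₂) pXY₂ (◁-⊕ʳ X Y₃◁Y₂))

no-counterexample : Acc _◁⁺_ X → Acc _◁⁺_ Y → ¬ Counterexample X Y
no-counterexample (acc rX) (acc rY) c with smaller-counterexample c
... | inj₁ (X′ , X′◁⁺X , c′) = no-counterexample (rX X′◁⁺X) (acc rY) c′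
... | inj₂ (Y′ , Y′◁⁺Y , c′) = no-counterexample (acc rX) (rY Y′◁⁺Y) c′

claim7 : ¬ Σ Game (λ X → Σ Game (λ Y → isO X × isO Y × isO (X ⊕ Y)))
claim7 (X , Y , c) = no-counterexample (◁⁺-wellFounded X) (◁⁺-wellFounded Y) c
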